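{- Let $k$ be a positive integer and let $G$ be a finite simple graph which is the union of a family $\mathcal{L}$ of $k$ pairwise edge-disjoint copies of $K_k$ (so $V(G)$ and $E(G)$ are the unions of the vertex and edge sets of the cliques in $\mathcal{L}$). Then $\omega(G)=k$. Furthermore, if some maximal clique of $G$ of size $k$ does not belong to $\mathcal{L}$, then $G$ is chordal.
   Context: A graph is chordal if it has no induced cycle of length at least $4$. $\omega(G)$ is the clique number of $G$. -}

module Defs where

open import Data.Nat using (ℕ; zero; suc; _≤_)
open import Data.Fin using (Fin; toℕ)
open import Data.Fin.Subset using (Subset; _∈_; _⊆_; ∣_∣)
open import Data.Product using (Σ; ∃; _×_; _,_)
open import Data.Sum using (_⊎_)
open import Relation.Nullary using (¬_)
open import Relation.Binary.PropositionalEquality using (_≡_; _≢_; refl)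
import Relation.Binary.PropositionalEquality as Eq
open import Function.Definitions using (Injective)
open import Function.Bundles using (_⇔_)

record Graph (n : ℕ) : Set₁ where
  field
    Adj   : Fin n → Fin n → Set
    irrefl : ∀ {u} → ¬ Adj u u
    sym    : ∀ {u v} → Adj u v → Adj v u

open Graph public

UnionAdj : ∀ {n k} → (Fin k → Subset n) → Fin n → Fin n → Set
UnionAdj {k = k} C u v = (u ≢ v) × ∃ λ (i : Fin k) → (u ∈ C i) × (v ∈ C i)

unionGraph : ∀ {n k} → (Fin k → Subset n) → Graph n
unionGraph C = record
  { Adj = UnionAdj C
  ; irrefl = λ { (u≢u , _) → u≢u refl }
  ; sym = λ { (u≢v , i , ui , vi) → (λ e → u≢v (Eq.sym e)) , i , vi , ui }
  }

Covers : ∀ {n k} → (Fin k → Subset n) → Set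
Covers {n} {k} C = ∀ (v : Fin n) → ∃ λ (i : Fin k) → v ∈ C i

EdgeDisjoint : ∀ {n k} → (Fin k → Subset n) → Set
EdgeDisjoint {n} {k} C = ∀ (i j : Fin k) → i ≢ j → ∀ (u v : Fin n) → u ≢ v →
  ¬ ((u ∈ C i) × (v ∈ C i) × (u ∈ C j) × (v ∈ C j))

IsClique : ∀ {n} → Graph n → Subset n → Set
IsClique G S = ∀ u v → u ∈ S → v ∈ S → u ≢ v → Adj G u v

IsMaximalClique : ∀ {n} → Graph n → Subset n → Set
IsMaximalClique G S = IsClique G S × (∀ T → IsClique G T → S ⊆ T → T ≡ S)

CliqueNumberIs : ∀ {n} → Graph n → ℕ → Set
CliqueNumberIs {n} G w =
  (∃ λ (S : Subset n) → IsClique G S × (∣ S ∣ ≡ w)) × (∀ S → IsClique G S → ∣ S ∣ ≤ w)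

CycleAdj : (m : ℕ) → Fin m → Fin m → Set
CycleAdj m i j =
  (suc (toℕ i) ≡ toℕ j) ⊎ (suc (toℕ j) ≡ toℕ i)
  ⊎ ((toℕ i ≡ 0) × (suc (toℕ j) ≡ m)) ⊎ ((toℕ j ≡ 0) × (suc (toℕ i) ≡ m))

IsInducedCycle : ∀ {n} → Graph n → (m : ℕ) → (Fin m → Fin n) → Set
IsInducedCycle G m v = Injective _≡_ _≡_ v × (∀ i j → (Adj G (v i) (v j) ⇔ CycleAdj m i j))

Chordal : ∀ {n} → Graph n → Set
Chordal {n} G = ∀ (m : ℕ) → 4 ≤ m → (v : Fin m → Fin n) → ¬ IsInducedCycle G m v

module Submission where

-- The weighted double counting argument of Conway for the de Bruijn–Erdős theorem,
-- applied to the cliques C i as "lines".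
--
-- A clique T of G = ⋃ C i either lies in one C i (so |T| ≤ k), or its vertices with
-- the lines C i form a linear space: two points share exactly one line, since the C i
-- are edge-disjoint and T is a clique.  Conway's proof of de Bruijn–Erdős then gives
-- |T| ≤ k.  It rests on the basic inequality |L| ≤ r(v) for a point v off a line L
-- (r(v) = number of lines through v), turned into an exact comparison of the sums
-- Σ 1/(s·(k - r v)) and Σ 1/(k·(s - |L|)) over antiflags, both of which equal 1.
-- Fractions are avoided by scaling with a common multiple D = (n·k)!.  In the extremal
-- case |S| = k that comparison is tight, so |L| = r(v) for every antiflag; this forces
-- each vertex outside a k-clique S ⊄ C i to lie in a single C i.  Such vertices are
-- simplicial, and a graph whose non-simplicial vertices form a clique is chordal.

open import Defs hiding (sym)
open import Data.Nat using (ℕ; zero; suc; _+_; _*_; _≤_; _<_; _≤?_; z≤n; s≤s; _!; ≢-nonZero; >-nonZero)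
import Data.Nat as ℕ
open import Data.Nat.Properties hiding (_≟_)
open import Data.Nat.DivMod using (_/_; m*[n/m]≡n; /-monoʳ-≤)
open import Data.Nat.Divisibility using (_∣_; m≤n⇒m!∣n!; ∣-trans; m∣m*n)
open import Data.Bool using (Bool; true; false; not; _∧_)
open import Data.Bool.Properties using (∧-identityʳ)
open import Data.Fin using (Fin; zero; suc; toℕ; fromℕ<)
open import Data.Fin.Properties using (_≟_; ¬∀⟶∃¬; toℕ<n; toℕ-fromℕ<; any?)
import Data.Fin.Properties as Finₚ
open import Data.Fin.Subset using (Subset; _∈_; _∉_; _⊆_; ∣_∣)
open import Data.Fin.Subset.Properties using (_∈?_; _⊆?_; p⊆q⇒∣p∣≤∣q∣)
open import Data.Vec using (lookup; []; _∷_)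
open import Data.Vec.Properties using ([]=⇒lookup; lookup⇒[]=)
open import Data.Product using (Σ; ∃; _×_; _,_; proj₁; proj₂)
open import Data.Sum using (_⊎_; inj₁; inj₂)
open import Data.Empty using (⊥; ⊥-elim)
open import Function using (_∘_; flip)
open import Function.Bundles using (Equivalence)
open import Relation.Nullary using (¬_; does; yes; no; contradiction)
open import Relation.Nullary.Decidable using (¬?; _×-dec_)
open import Relation.Binary.PropositionalEquality
open import Algebra.Properties.Semiring.Sum +-*-semiring
  using (sum; sum-syntax; sum-cong-≗; ∑-distrib-+; ∑-comm; *-distribˡ-sum; *-distribʳ-sum)

sum-const : ∀ {n} c → ∑[ x < n ] c ≡ n * c
sum-const {zero}  c = refl
sum-const {suc n} c = cong (c +_) (sum-const {n} c)

sum-mono : ∀ {n} {f g : Fin n → ℕ} → (∀ x → f x ≤ g x) → sum f ≤ sum g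
sum-mono {zero}  f≤g = z≤n
sum-mono {suc n} f≤g = +-mono-≤ (f≤g zero) (sum-mono (f≤g ∘ suc))

term≤sum : ∀ {n} (f : Fin n → ℕ) x → f x ≤ sum f
term≤sum f zero    = m≤m+n (f zero) _
term≤sum f (suc x) = m≤n⇒m≤o+n (f zero) (term≤sum (f ∘ suc) x)

sum-mono-tight : ∀ {n} {f g : Fin n → ℕ} → (∀ x → f x ≤ g x) → sum f ≡ sum g →
  ∀ x → f x ≡ g x
sum-mono-tight {suc n} {f} {g} f≤g eq x = go x
  where
  head≡ : f zero ≡ g zero
  head≡ = ≤-antisym (f≤g zero) (+-cancelʳ-≤ (sum (f ∘ suc)) (g zero) (f zero) (begin
    g zero + sum (f ∘ suc) ≤⟨ +-monoʳ-≤ (g zero) (sum-mono (f≤g ∘ suc)) ⟩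
    g zero + sum (g ∘ suc) ≡⟨ sym eq ⟩
    f zero + sum (f ∘ suc) ∎))
    where open ≤-Reasoning
  go : ∀ x → f x ≡ g x
  go zero    = head≡
  go (suc x) = sum-mono-tight (f≤g ∘ suc)
    (+-cancelˡ-≡ (f zero) _ _ (trans eq (cong (_+ sum (g ∘ suc)) (sym head≡)))) x

ind : Bool → ℕ
ind true  = 1
ind false = 0

count : ∀ {n} → (Fin n → Bool) → ℕ
count {n} P = ∑[ x < n ] ind (P x)

count-all : ∀ {n} → count {n} (λ _ → true) ≡ n
count-all {n} = trans (sum-const {n} 1) (*-identityʳ n)

count≤ : ∀ {n} (P : Fin n → Bool) → count P ≤ n
count≤ P = ≤-trans (sum-mono (λ x → ind≤1 (P x))) (≤-reflexive count-all)
  where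
  ind≤1 : ∀ b → ind b ≤ 1
  ind≤1 true  = ≤-refl
  ind≤1 false = z≤n

count-pos : ∀ {n} (P : Fin n → Bool) x → P x ≡ true → 1 ≤ count P
count-pos P x Px = subst (_≤ count P) (cong ind Px) (term≤sum (ind ∘ P) x)

count-none : ∀ {n} (P : Fin n → Bool) → (∀ x → P x ≡ false) → count P ≡ 0
count-none {n} P none = trans (sum-cong-≗ (cong ind ∘ none)) (trans (sum-const {n} 0) (*-zeroʳ n))

count-witness : ∀ {n} (P : Fin n → Bool) → 1 ≤ count P → ∃ λ x → P x ≡ true
count-witness {suc n} P pos with P zero in P0
... | true  = zero , P0
... | false = let x , Px = count-witness (P ∘ suc) pos in suc x , Px

count-split : ∀ {n} (P Q : Fin n → Bool) →
  count (λ x → P x ∧ not (Q x)) + count (λ x → P x ∧ Q x) ≡ count P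
count-split P Q = trans (sym (∑-distrib-+ (λ x → ind (P x ∧ not (Q x))) (λ x → ind (P x ∧ Q x))))
  (sum-cong-≗ (λ x → split (P x) (Q x)))
  where
  split : ∀ a b → ind (a ∧ not b) + ind (a ∧ b) ≡ ind a
  split true  true  = refl
  split true  false = refl
  split false _     = refl

count-complement : ∀ {n} (P : Fin n → Bool) → count (not ∘ P) + count P ≡ n
count-complement P = trans (count-split (λ _ → true) P) count-all

count-remove : ∀ {n} (P : Fin n → Bool) j → P j ≡ true →
  count P ≡ suc (count (λ x → P x ∧ not (does (x ≟ j))))
count-remove {suc n} P zero Pj rewrite Pj =
  cong suc (sum-cong-≗ (λ x → cong ind (sym (∧-identityʳ (P (suc x))))))
count-remove {suc n} P (suc j) Pj with P zero
... | true  = cong suc (count-remove (P ∘ suc) j Pj)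
... | false = count-remove (P ∘ suc) j Pj

-- An injection f from the elements satisfying P into those satisfying Q shows
-- count P ≤ count Q; the first element is sent to j, which is removed from Q.
count-injection : ∀ {n k} (P : Fin n → Bool) (Q : Fin k → Bool)
  (f : ∀ u → P u ≡ true → Fin k) → (∀ u p → Q (f u p) ≡ true) →
  (∀ u w p q → f u p ≡ f w q → u ≡ w) → count P ≤ count Q
count-injection {zero}  P Q f f∈Q f-inj = z≤n
count-injection {suc n} P Q f f∈Q f-inj with P zero in P0
... | false = count-injection (P ∘ suc) Q (f ∘ suc) (f∈Q ∘ suc)
  (λ u w p q eq → Finₚ.suc-injective (f-inj (suc u) (suc w) p q eq))
... | true  = subst (suc _ ≤_) (sym (count-remove Q j (f∈Q zero P0)))
  (s≤s (count-injection (P ∘ suc) Q′ (f ∘ suc) f∈Q′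
    (λ u w p q eq → Finₚ.suc-injective (f-inj (suc u) (suc w) p q eq))))
  where
  j : Fin _
  j = f zero P0
  Q′ : Fin _ → Bool
  Q′ x = Q x ∧ not (does (x ≟ j))
  f∈Q′ : ∀ u p → Q′ (f (suc u) p) ≡ true
  f∈Q′ u p with f (suc u) p ≟ j
  ... | yes eq = ⊥-elim (Finₚ.0≢1+n (f-inj zero (suc u) P0 p (sym eq)))
  ... | no _   = cong (_∧ true) (f∈Q (suc u) p)

-- D ÷ x is the quotient D / x, read as 0 for x = 0.  For D a common multiple
-- of the denominators in play, D ÷ x represents the unit fraction 1/x.
_÷_ : ℕ → ℕ → ℕ
D ÷ zero  = 0
D ÷ suc x = D / suc x

÷-inverse : ∀ {D x} → 1 ≤ x → x ∣ D → x * (D ÷ x) ≡ D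
÷-inverse {x = suc x} _ x∣D = m*[n/m]≡n x∣D

÷-antitone : ∀ {D x y} → 1 ≤ x → x ≤ y → D ÷ y ≤ D ÷ x
÷-antitone {D} {suc x} {suc y} _ x≤y = /-monoʳ-≤ D x≤y

÷-injective : ∀ {D x y} → 1 ≤ D → 1 ≤ x → 1 ≤ y → x ∣ D → y ∣ D → D ÷ x ≡ D ÷ y → x ≡ y
÷-injective {D} {x} {y} D≥1 x≥1 y≥1 x∣D y∣D eq =
  *-cancelʳ-≡ x y (D ÷ x) ⦃ ≢-nonZero quotient≢0 ⦄ (begin
    x * (D ÷ x) ≡⟨ ÷-inverse x≥1 x∣D ⟩
    D           ≡⟨ ÷-inverse y≥1 y∣D ⟨
    y * (D ÷ y) ≡⟨ cong (y *_) eq ⟨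
    y * (D ÷ x) ∎)
  where
  open ≡-Reasoning
  quotient≢0 : D ÷ x ≢ 0
  quotient≢0 q≡0 = <⇒≢ D≥1 (sym (trans (sym (÷-inverse x≥1 x∣D)) (trans (cong (x *_) q≡0) (*-zeroʳ x))))

∣-factorial : ∀ {x N} → 1 ≤ x → x ≤ N → x ∣ N !
∣-factorial {suc x} _ x≤N = ∣-trans (m∣m*n (x !)) (m≤n⇒m!∣n! x≤N)

-- Weights of a relation A ⊆ Fin n × Fin k whose rows lie in R, every row of R being
-- nonempty: giving the pair (v , i) ∈ A the weight 1/(|R|·|row v|), the total is 1.
-- Here everything is scaled by a common multiple D of the denominators.
total-row-weight : ∀ {n k} (A : Fin n → Fin k → Bool) (R : Fin n → Bool) (D : ℕ) →
  (∀ v i → A v i ≡ true → R v ≡ true) → (∀ v → R v ≡ true → 1 ≤ count (A v)) →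
  (∀ v → R v ≡ true → count R * count (A v) ∣ D) → 1 ≤ count R →
  ∑[ v < n ] ∑[ i < k ] (ind (A v i) * (D ÷ (count R * count (A v)))) ≡ D
total-row-weight {n} {k} A R D A⊆R rows-nonempty divides p≥1 =
  *-cancelˡ-≡ _ D p ⦃ >-nonZero p≥1 ⦄ (begin
    p * sum row                       ≡⟨ *-distribˡ-sum p row ⟩
    sum (λ v → p * row v)             ≡⟨ sum-cong-≗ (λ v → scaled-row v (R v) refl) ⟩
    sum (λ v → ind (R v) * D)         ≡⟨ *-distribʳ-sum D (ind ∘ R) ⟨
    p * D                             ∎)
  where
  open ≡-Reasoning
  p : ℕ
  p = count R
  weight : Fin n → ℕ
  weight v = D ÷ (p * count (A v))
  row : Fin n → ℕ
  row v = ∑[ i < k ] (ind (A v i) * weight v)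
  scaled-row : ∀ v b → R v ≡ b → p * row v ≡ ind b * D
  scaled-row v b Rv≡b = begin
    p * row v                    ≡⟨ cong (p *_) (*-distribʳ-sum (weight v) (ind ∘ A v)) ⟨
    p * (count (A v) * weight v) ≡⟨ *-assoc p (count (A v)) (weight v) ⟨
    p * count (A v) * weight v   ≡⟨ by-membership b Rv≡b ⟩
    ind b * D                    ∎
    where
    by-membership : ∀ b → R v ≡ b → p * count (A v) * weight v ≡ ind b * D
    by-membership true  Rv = trans (÷-inverse (*-mono-≤ p≥1 (rows-nonempty v Rv)) (divides v Rv))
                                   (sym (+-identityʳ D))
    by-membership false Rv = begin
      p * count (A v) * weight v ≡⟨ cong (λ c → p * c * weight v) (count-none (A v) outside-A) ⟩
      p * 0 * weight v           ≡⟨ cong (_* weight v) (*-zeroʳ p) ⟩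
      0                          ∎
      where
      outside-A : ∀ i → A v i ≡ false
      outside-A i with A v i in Avi
      ... | false = refl
      ... | true with () ← trans (sym (A⊆R v i Avi)) Rv

-- Let A ⊆ Fin n × Fin k have its rows in R and its columns
-- in K, every row of R and every column of K being nonempty, and write p = |R|,
-- q = |K|, α v = |row v|, β i = |column i|.  Both Σ_{(v,i) ∈ A} 1/(p·α v) and
-- Σ_{(v,i) ∈ A} 1/(q·β i) equal 1, so if p·α v ≤ q·β i on all of A, the termwise
-- inequality between them is an equality on all of A.
double-counting-tight : ∀ {n k} (A : Fin n → Fin k → Bool) (R : Fin n → Bool) (K : Fin k → Bool) →
  (∀ v i → A v i ≡ true → R v ≡ true) → (∀ v i → A v i ≡ true → K i ≡ true) →
  (∀ v → R v ≡ true → 1 ≤ count (A v)) → (∀ i → K i ≡ true → 1 ≤ count (λ v → A v i)) →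
  (∀ v i → A v i ≡ true → count R * count (A v) ≤ count K * count (λ v → A v i)) →
  ∀ v i → A v i ≡ true → count R * count (A v) ≡ count K * count (λ v → A v i)
double-counting-tight {n} {k} A R K A⊆R A⊆K rows-nonempty cols-nonempty x≤y v₀ i₀ Av₀i₀ =
  ÷-injective (1≤n! (n * k)) (x≥1 Rv₀) (y≥1 Ki₀) (x∣D Rv₀) (y∣D Ki₀) (sym weights-agree)
  where
  Rv₀ : R v₀ ≡ true
  Rv₀ = A⊆R v₀ i₀ Av₀i₀
  Ki₀ : K i₀ ≡ true
  Ki₀ = A⊆K v₀ i₀ Av₀i₀
  p q D : ℕ
  p = count R
  q = count K
  D = (n * k) !
  x : Fin n → ℕ
  x v = p * count (A v)
  y : Fin k → ℕ
  y i = q * count (λ v → A v i)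
  x≥1 : ∀ {v} → R v ≡ true → 1 ≤ x v
  x≥1 {v} Rv = *-mono-≤ (count-pos R v Rv) (rows-nonempty v Rv)
  y≥1 : ∀ {i} → K i ≡ true → 1 ≤ y i
  y≥1 {i} Ki = *-mono-≤ (count-pos K i Ki) (cols-nonempty i Ki)
  x∣D : ∀ {v} → R v ≡ true → x v ∣ D
  x∣D {v} Rv = ∣-factorial (x≥1 Rv) (*-mono-≤ (count≤ R) (count≤ (A v)))
  y∣D : ∀ {i} → K i ≡ true → y i ∣ D
  y∣D {i} Ki = ∣-factorial (y≥1 Ki)
    (≤-trans (*-mono-≤ (count≤ K) (count≤ (λ v → A v i))) (≤-reflexive (*-comm k n)))
  F G : Fin n → Fin k → ℕ
  F v i = ind (A v i) * (D ÷ x v)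
  G v i = ind (A v i) * (D ÷ y i)
  G≤F : ∀ v i → G v i ≤ F v i
  G≤F v i with A v i in Avi
  ... | false = z≤n
  ... | true  = *-monoʳ-≤ 1 (÷-antitone (x≥1 (A⊆R v i Avi)) (x≤y v i Avi))
  -- both totals are D: by columns for G, by rows for F
  G≡F : ∑[ v < n ] ∑[ i < k ] G v i ≡ ∑[ v < n ] ∑[ i < k ] F v i
  G≡F = begin
    ∑[ v < n ] ∑[ i < k ] G v i ≡⟨ ∑-comm G ⟩
    ∑[ i < k ] ∑[ v < n ] G v i ≡⟨ total-row-weight (flip A) K D (flip A⊆K) cols-nonempty
                                     (λ i → y∣D) (count-pos K i₀ Ki₀) ⟩
    D                           ≡⟨ total-row-weight A R D A⊆R rows-nonempty
                                     (λ v → x∣D) (count-pos R v₀ Rv₀) ⟨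
    ∑[ v < n ] ∑[ i < k ] F v i ∎
    where open ≡-Reasoning
  -- the totals agree and G ≤ F termwise, so G = F termwise; at (v₀ , i₀) this compares weights
  weights-agree : D ÷ y i₀ ≡ D ÷ x v₀
  weights-agree = drop-indicator Av₀i₀
    (sum-mono-tight (G≤F v₀) (sum-mono-tight (λ v → sum-mono (G≤F v)) G≡F v₀) i₀)
    where
    drop-indicator : ∀ {b a c} → b ≡ true → ind b * a ≡ ind b * c → a ≡ c
    drop-indicator {a = a} {c} refl e = trans (sym (+-identityʳ a)) (trans e (+-identityʳ c))

∈⇒true : ∀ {n} {x : Fin n} {p : Subset n} → x ∈ p → lookup p x ≡ true
∈⇒true = []=⇒lookup

true⇒∈ : ∀ {n} {x : Fin n} {p : Subset n} → lookup p x ≡ true → x ∈ p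
true⇒∈ {x = x} {p} = lookup⇒[]= x p

∉⇒false : ∀ {n} {x : Fin n} {p : Subset n} → x ∉ p → lookup p x ≡ false
∉⇒false {x = x} {p} x∉p with lookup p x in eq
... | true  = contradiction (true⇒∈ eq) x∉p
... | false = refl

∣∣≡count : ∀ {n} (p : Subset n) → ∣ p ∣ ≡ count (lookup p)
∣∣≡count []          = refl
∣∣≡count (true ∷ p)  = cong suc (∣∣≡count p)
∣∣≡count (false ∷ p) = ∣∣≡count p

∧-true : ∀ {a b} → a ≡ true → b ≡ true → a ∧ b ≡ true
∧-true refl refl = refl

∧-trueˡ : ∀ {a b} → a ∧ b ≡ true → a ≡ true
∧-trueˡ {true} _ = refl

∧-trueʳ : ∀ {a b} → a ∧ b ≡ true → b ≡ true
∧-trueʳ {true} b≡true = b≡true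

+-trade-≤ : ∀ {a b c d} → a + b ≡ c + d → d ≤ b → a ≤ c
+-trade-≤ {a} {b} {c} {d} eq d≤b = +-cancelʳ-≤ d a c (≤-trans (+-monoʳ-≤ a d≤b) (≤-reflexive eq))

+-trade-≡ : ∀ {a b c d} → a + b ≡ c + d → a ≡ c → b ≡ d
+-trade-≡ {a} eq refl = +-cancelˡ-≡ a _ _ eq

module LinearSpace {n k} (S : Subset n) (L : Fin k → Subset n)
  (disjoint : EdgeDisjoint L)
  (join : ∀ u v → u ∈ S → v ∈ S → u ≢ v → ∃ λ i → u ∈ L i × v ∈ L i)
  (proper : ∀ i → ∃ λ u → u ∈ S × u ∉ L i)
  (covers : Covers L) where

  point : Fin n → Bool
  point = lookup S

  on : Fin k → Fin n → Bool
  on i = lookup (L i)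

  s : ℕ
  s = count point

  r : Fin n → ℕ
  r v = count (λ i → on i v)

  size : Fin k → ℕ
  size i = count (λ v → point v ∧ on i v)

  antiflag : Fin n → Fin k → Bool
  antiflag v i = point v ∧ not (on i v)

  antiflag-true : ∀ {v i} → v ∈ S → v ∉ L i → antiflag v i ≡ true
  antiflag-true v∈S v∉Li = ∧-true (∈⇒true v∈S) (cong not (∉⇒false v∉Li))

  antiflag-point : ∀ {v i} → antiflag v i ≡ true → v ∈ S
  antiflag-point a = true⇒∈ (∧-trueˡ a)

  antiflag-line : ∀ {v i} → antiflag v i ≡ true → v ∉ L i
  antiflag-line a v∈Li with () ← trans (sym (∧-trueʳ a)) (cong not (∈⇒true v∈Li))

  antiflags-at-point : ∀ v → v ∈ S → count (antiflag v) + r v ≡ k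
  antiflags-at-point v v∈S rewrite ∈⇒true v∈S = count-complement (λ i → on i v)

  antiflags-at-line : ∀ i → count (λ v → antiflag v i) + size i ≡ s
  antiflags-at-line i = count-split point (on i)

  -- Joining a point v off the line L i to the points of L i gives distinct lines through v,
  -- as two of them coinciding would share two vertices with L i.
  joins-bound : ∀ v i → v ∈ S → v ∉ L i → (Q : Fin k → Bool) →
    (∀ u j → u ∈ S → u ∈ L i → v ∈ L j → u ∈ L j → Q j ≡ true) → size i ≤ count Q
  joins-bound v i v∈S v∉Li Q joins∈Q = count-injection _ Q line-to line-to∈Q line-to-injective
    where
    ≢v : ∀ u → point u ∧ on i u ≡ true → u ≢ v
    ≢v u p refl = v∉Li (true⇒∈ (∧-trueʳ p))
    joining : ∀ u → point u ∧ on i u ≡ true → ∃ λ j → u ∈ L j × v ∈ L j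
    joining u p = join u v (true⇒∈ (∧-trueˡ p)) v∈S (≢v u p)
    line-to : ∀ u → point u ∧ on i u ≡ true → Fin k
    line-to u p = proj₁ (joining u p)
    line-to∈Q : ∀ u p → Q (line-to u p) ≡ true
    line-to∈Q u p = let (_ , u∈Lj , v∈Lj) = joining u p in
      joins∈Q u _ (true⇒∈ (∧-trueˡ p)) (true⇒∈ (∧-trueʳ p)) v∈Lj u∈Lj
    line-to-injective : ∀ u w p q → line-to u p ≡ line-to w q → u ≡ w
    line-to-injective u w p q eq with u ≟ w | joining u p | joining w q
    ... | yes u≡w | _ | _ = u≡w
    ... | no u≢w | j , u∈Lj , v∈Lj | _ , w∈Lj′ , _ = ⊥-elim (disjoint i j i≢j u w u≢w
          (true⇒∈ (∧-trueʳ p) , true⇒∈ (∧-trueʳ q) , u∈Lj , subst (λ t → w ∈ L t) (sym eq) w∈Lj′))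
      where
      i≢j : i ≢ j
      i≢j refl = v∉Li v∈Lj

  size≤r : ∀ v i → v ∈ S → v ∉ L i → size i ≤ r v
  size≤r v i v∈S v∉Li = joins-bound v i v∈S v∉Li (λ j → on j v) (λ _ _ _ _ v∈Lj _ → ∈⇒true v∈Lj)

  r≥1 : ∀ v → 1 ≤ r v
  r≥1 v = let (i , v∈Li) = covers v in count-pos (λ i → on i v) i (∈⇒true v∈Li)

  -- No point lies on all lines: otherwise, taking w off a line through it, a line through
  -- v and w, and z off that line, the line through z and w would share v and w with it.
  point-misses-line : ∀ v → v ∈ S → ∃ λ i → v ∉ L i
  point-misses-line v v∈S = ¬∀⟶∃¬ k (λ i → v ∈ L i) (λ i → v ∈? L i) on-all
    where
    on-all : ¬ (∀ i → v ∈ L i)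
    on-all v∈all with proper (proj₁ (covers v))
    ... | w , w∈S , w∉Li₀ with join w v w∈S v∈S (λ { refl → w∉Li₀ (v∈all _) })
    ... | j , w∈Lj , v∈Lj with proper j
    ... | z , z∈S , z∉Lj with join z w z∈S w∈S (λ { refl → z∉Lj w∈Lj })
    ... | m , z∈Lm , w∈Lm = disjoint j m (λ { refl → z∉Lj z∈Lm }) v w (λ { refl → w∉Li₀ (v∈all _) })
          (v∈Lj , w∈Lj , v∈all m , w∈Lm)

  antiflags-at-point≥1 : ∀ v → point v ≡ true → 1 ≤ count (antiflag v)
  antiflags-at-point≥1 v v∈S with point-misses-line v (true⇒∈ v∈S)
  ... | i , v∉Li = count-pos (antiflag v) i (antiflag-true (true⇒∈ v∈S) v∉Li)

  antiflags-at-line≥1 : ∀ i → true ≡ true → 1 ≤ count (λ u → antiflag u i)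
  antiflags-at-line≥1 i _ with proper i
  ... | u , u∈S , u∉Li = count-pos (λ u → antiflag u i) u (antiflag-true u∈S u∉Li)

  antiflag-products : ∀ v i → v ∈ S →
    s * count (antiflag v) + s * r v ≡ k * count (λ u → antiflag u i) + k * size i
  antiflag-products v i v∈S = begin
    s * count (antiflag v) + s * r v            ≡⟨ *-distribˡ-+ s _ _ ⟨
    s * (count (antiflag v) + r v)              ≡⟨ cong (s *_) (antiflags-at-point v v∈S) ⟩
    s * k                                       ≡⟨ *-comm s k ⟩
    k * s                                       ≡⟨ cong (k *_) (antiflags-at-line i) ⟨
    k * (count (λ u → antiflag u i) + size i)   ≡⟨ *-distribˡ-+ k _ _ ⟩
    k * count (λ u → antiflag u i) + k * size i ∎
    where open ≡-Reasoning

  -- Conway's double counting applied to the antiflags: when there are at least as many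
  -- points as lines, every antiflag (v , i) satisfies s · r v = k · size i.
  balanced : k ≤ s → ∀ v i → v ∈ S → v ∉ L i → s * r v ≡ k * size i
  balanced k≤s v i v∈S v∉Li =
    +-trade-≡ (antiflag-products v i v∈S) (antiflag-weights-tight v i (antiflag-true v∈S v∉Li))
    where
    -- from size i ≤ r v and k ≤ s
    antiflag-weights : ∀ v i → antiflag v i ≡ true →
      s * count (antiflag v) ≤ k * count (λ u → antiflag u i)
    antiflag-weights v i a = +-trade-≤ (antiflag-products v i (antiflag-point a)) (begin
      k * size i ≤⟨ *-monoʳ-≤ k (size≤r v i (antiflag-point a) (antiflag-line a)) ⟩
      k * r v    ≤⟨ *-monoˡ-≤ (r v) k≤s ⟩
      s * r v    ∎)
      where open ≤-Reasoning
    -- the columns of the antiflag relation are indexed by all k lines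
    all-lines : ∀ {a b} → a ≤ k * b → a ≤ count (λ (_ : Fin k) → true) * b
    all-lines {b = b} = subst (λ q → _ ≤ q * b) (sym (count-all {k}))
    antiflag-weights-tight : ∀ v i → antiflag v i ≡ true →
      s * count (antiflag v) ≡ k * count (λ u → antiflag u i)
    antiflag-weights-tight v i a = trans
      (double-counting-tight antiflag point (λ _ → true) (λ _ _ → ∧-trueˡ) (λ _ _ _ → refl)
        antiflags-at-point≥1 antiflags-at-line≥1 (λ v i a → all-lines (antiflag-weights v i a)) v i a)
      (cong (_* count (λ u → antiflag u i)) (count-all {k}))

  -- With fewer lines than points, any antiflag would give s · r v = k · size i ≤ k · r v < s · r v.
  fewer-lines-impossible : k < s → ∀ v i → v ∈ S → v ∉ L i → ⊥
  fewer-lines-impossible k<s v i v∈S v∉Li = <-irrefl refl (begin-strict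
    s * r v    ≡⟨ balanced (<⇒≤ k<s) v i v∈S v∉Li ⟩
    k * size i ≤⟨ *-monoʳ-≤ k (size≤r v i v∈S v∉Li) ⟩
    k * r v    <⟨ *-monoˡ-< (r v) ⦃ >-nonZero (r≥1 v) ⦄ k<s ⟩
    s * r v    ∎)
    where open ≤-Reasoning

  points≤lines : s ≤ k
  points≤lines with s ≤? k
  ... | yes s≤k = s≤k
  ... | no  s≰k with count-witness point (≤-trans (s≤s z≤n) (≰⇒> s≰k))
  ... | v , v∈S with point-misses-line v (true⇒∈ v∈S)
  ... | i , v∉Li = ⊥-elim (fewer-lines-impossible (≰⇒> s≰k) v i (true⇒∈ v∈S) v∉Li)

  extremal : s ≡ k → ∀ v i → v ∈ S → v ∉ L i → r v ≡ size i
  extremal s≡k v i v∈S v∉Li = *-cancelˡ-≡ (r v) (size i) k ⦃ >-nonZero k≥1 ⦄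
    (subst (λ t → t * r v ≡ k * size i) s≡k (balanced (≤-reflexive (sym s≡k)) v i v∈S v∉Li))
    where
    k≥1 : 1 ≤ k
    k≥1 = ≤-trans (r≥1 v) (count≤ (λ j → on j v))

  -- In the extremal case, if a vertex x ∉ S lies on two lines L i ≠ L j, then L i has no
  -- point a: a is off L j, and joining a to the points of L j never gives L i (it would
  -- share two vertices with L j), so size j ≤ r a - 1 < r a = size j.
  extremal-no-point : s ≡ k → ∀ x a i j → x ∉ S → x ∈ L i → x ∈ L j → i ≢ j →
    a ∈ S → a ∈ L i → ⊥
  extremal-no-point s≡k x a i j x∉S x∈Li x∈Lj i≢j a∈S a∈Li = <-irrefl refl (begin-strict
      size j            ≤⟨ joins-bound a j a∈S a∉Lj others-at-a joins-avoid-Li ⟩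
      count others-at-a <⟨ ≤-reflexive (sym (count-remove (λ j′ → on j′ a) i (∈⇒true a∈Li))) ⟩
      r a               ≡⟨ extremal s≡k a j a∈S a∉Lj ⟩
      size j            ∎)
    where
    open ≤-Reasoning
    a∉Lj : a ∉ L j
    a∉Lj a∈Lj = disjoint i j i≢j x a (λ { refl → x∉S a∈S }) (x∈Li , a∈Li , x∈Lj , a∈Lj)
    others-at-a : Fin k → Bool
    others-at-a j′ = on j′ a ∧ not (does (j′ ≟ i))
    joins-avoid-Li : ∀ u j′ → u ∈ S → u ∈ L j → a ∈ L j′ → u ∈ L j′ → others-at-a j′ ≡ true
    joins-avoid-Li u j′ u∈S u∈Lj a∈Lj′ u∈Lj′ with j′ ≟ i
    ... | no _     = ∧-true (∈⇒true a∈Lj′) refl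
    ... | yes refl = ⊥-elim (disjoint i j i≢j u x (λ { refl → x∉S u∈S }) (u∈Lj′ , x∈Li , u∈Lj , x∈Lj))

  -- In the extremal case every line has a point: size i = r w ≥ 1 for any point w off it.
  extremal-line-nonempty : s ≡ k → ∀ i → 1 ≤ size i
  extremal-line-nonempty s≡k i with proper i
  ... | w , w∈S , w∉Li = ≤-trans (r≥1 w) (≤-reflexive (extremal s≡k w i w∈S w∉Li))

  outside-unique : s ≡ k → ∀ x i j → x ∉ S → x ∈ L i → x ∈ L j → i ≡ j
  outside-unique s≡k x i j x∉S x∈Li x∈Lj with i ≟ j
  ... | yes i≡j = i≡j
  ... | no  i≢j with count-witness (λ v → point v ∧ on i v) (extremal-line-nonempty s≡k i)
  ... | a , a∈S∩Li = ⊥-elim (extremal-no-point s≡k x a i j x∉S x∈Li x∈Lj i≢j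
        (true⇒∈ (∧-trueˡ a∈S∩Li)) (true⇒∈ (∧-trueʳ a∈S∩Li)))

-- The adjacency of the cycle C_m on naturals: CycleAdj m i j is Consecutive m (toℕ i) (toℕ j).
Consecutive : ℕ → ℕ → ℕ → Set
Consecutive m a b = (suc a ≡ b) ⊎ (suc b ≡ a) ⊎ ((a ≡ 0) × (suc b ≡ m)) ⊎ ((b ≡ 0) × (suc a ≡ m))

consecutive-neighbours : ∀ m → 4 ≤ m → ∀ t → t < m → Σ ℕ λ a → Σ ℕ λ b →
  a < m × b < m × Consecutive m t b × Consecutive m a t × a ≢ b × ¬ Consecutive m a b
consecutive-neighbours _ (s≤s (s≤s (s≤s (s≤s {n = m′} _)))) zero _ =
  suc (suc (suc m′)) , 1 , ≤-refl , s≤s (s≤s z≤n) ,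
  inj₁ refl , inj₂ (inj₂ (inj₂ (refl , refl))) , (λ ()) , λ
    { (inj₁ ()) ; (inj₂ (inj₁ ())) ; (inj₂ (inj₂ (inj₁ (() , _)))) ; (inj₂ (inj₂ (inj₂ (() , _)))) }
consecutive-neighbours m 4≤m (suc t) t<m with suc (suc t) ℕ.≟ m
-- t + 1 is the last position: its neighbours are t and 0
... | yes last = t , 0 , <-trans (n<1+n t) t<m , ≤-trans (s≤s z≤n) t<m ,
      inj₂ (inj₂ (inj₂ (refl , last))) , inj₁ refl , t≢0 , not-consecutive
  where
  small≢m : ∀ {c} → c < 4 → c ≢ m
  small≢m c<4 refl = <⇒≱ c<4 4≤m
  t≢0 : t ≢ 0
  t≢0 refl = small≢m (s≤s (s≤s (s≤s z≤n))) last
  not-consecutive : ¬ Consecutive m t 0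
  not-consecutive (inj₁ ())
  not-consecutive (inj₂ (inj₁ refl))               = small≢m ≤-refl last
  not-consecutive (inj₂ (inj₂ (inj₁ (refl , _))))  = t≢0 refl
  not-consecutive (inj₂ (inj₂ (inj₂ (_ , last′)))) = 1+n≢n (trans last (sym last′))
-- otherwise its neighbours are t and t + 2
... | no not-last = t , suc (suc t) , <-trans (n<1+n t) t<m , ≤∧≢⇒< t<m not-last ,
      inj₁ refl , inj₁ refl , <⇒≢ (m<n+m t (s≤s z≤n)) , not-consecutive
  where
  not-consecutive : ¬ Consecutive m t (suc (suc t))
  not-consecutive (inj₁ e)                         = 1+n≢n (sym (suc-injective e))
  not-consecutive (inj₂ (inj₁ e))                  = <⇒≢ (m<n+m t (s≤s z≤n)) (sym e)
  not-consecutive (inj₂ (inj₂ (inj₁ (refl , 3≡m)))) = <⇒≱ ≤-refl (subst (4 ≤_) (sym 3≡m) 4≤m)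
  not-consecutive (inj₂ (inj₂ (inj₂ (() , _))))

cycle-neighbours : ∀ m → 4 ≤ m → (j : Fin m) → Σ (Fin m) λ p → Σ (Fin m) λ q →
  CycleAdj m j q × CycleAdj m p j × p ≢ q × ¬ CycleAdj m p q
cycle-neighbours m 4≤m j with consecutive-neighbours m 4≤m (toℕ j) (toℕ<n j)
... | a , b , a<m , b<m , j~b , a~j , a≢b , a≁b =
  fromℕ< a<m , fromℕ< b<m ,
  subst (Consecutive m (toℕ j)) (sym toℕ-q) j~b ,
  subst (λ c → Consecutive m c (toℕ j)) (sym toℕ-p) a~j ,
  (λ p≡q → a≢b (trans (sym toℕ-p) (trans (cong toℕ p≡q) toℕ-q))) ,
  (λ p~q → a≁b (subst₂ (Consecutive m) toℕ-p toℕ-q p~q))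
  where
  toℕ-p : toℕ (fromℕ< a<m) ≡ a
  toℕ-p = toℕ-fromℕ< a<m
  toℕ-q : toℕ (fromℕ< b<m) ≡ b
  toℕ-q = toℕ-fromℕ< b<m

Simplicial : ∀ {n} → Graph n → Fin n → Set
Simplicial G x = ∀ a b → Adj G x a → Adj G x b → a ≢ b → Adj G a b

-- On an induced
-- cycle of length ≥ 4 every vertex has two distinct, non-adjacent cycle neighbours; so
-- its vertices are all non-simplicial, hence all in S, and then those two are adjacent.
chordal-if-clique-covers-nonsimplicial : ∀ {n} (G : Graph n) (S : Subset n) → IsClique G S →
  (∀ x → x ∉ S → Simplicial G x) → Chordal G
chordal-if-clique-covers-nonsimplicial G S S-clique simplicial m 4≤m v (v-injective , adj⇔) =
  cycle-inside-S (fromℕ< (≤-trans (s≤s z≤n) 4≤m))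
  where
  adj→ : ∀ i j → Adj G (v i) (v j) → CycleAdj m i j
  adj→ i j = Equivalence.to (adj⇔ i j)
  adj← : ∀ i j → CycleAdj m i j → Adj G (v i) (v j)
  adj← i j = Equivalence.from (adj⇔ i j)
  not-simplicial : ∀ j → ¬ Simplicial G (v j)
  not-simplicial j simplicial-j with cycle-neighbours m 4≤m j
  ... | p , q , j~q , p~j , p≢q , p≁q = p≁q (adj→ p q (simplicial-j (v p) (v q)
        (Graph.sym G (adj← p j p~j)) (adj← j q j~q) (λ e → p≢q (v-injective e))))
  in-S : ∀ j → v j ∈ S
  in-S j with v j ∈? S
  ... | yes v[j]∈S = v[j]∈S
  ... | no  v[j]∉S = ⊥-elim (not-simplicial j (simplicial (v j) v[j]∉S))
  cycle-inside-S : Fin m → ⊥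
  cycle-inside-S j with cycle-neighbours m 4≤m j
  ... | p , q , _ , _ , p≢q , p≁q =
    p≁q (adj→ p q (S-clique (v p) (v q) (in-S p) (in-S q) (λ e → p≢q (v-injective e))))

not-subset-witness : ∀ {n} (T U : Subset n) → ¬ (T ⊆ U) → ∃ λ u → u ∈ T × u ∉ U
not-subset-witness T U T⊈U with any? (λ u → (u ∈? T) ×-dec ¬? (u ∈? U))
... | yes witness = witness
... | no  none    = ⊥-elim (T⊈U (λ {u} u∈T → in-U u u∈T))
  where
  in-U : ∀ u → u ∈ T → u ∈ U
  in-U u u∈T with u ∈? U
  ... | yes u∈U = u∈U
  ... | no  u∉U = ⊥-elim (none (u , u∈T , u∉U))

module UnionOfCliques {n k} (C : Fin k → Subset n) (disjoint : EdgeDisjoint C) (covers : Covers C) where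

  G : Graph n
  G = unionGraph C

  line-clique : ∀ i → IsClique G (C i)
  line-clique i u v u∈Ci v∈Ci u≢v = u≢v , i , u∈Ci , v∈Ci

  -- Points of a clique S together with the lines C i form a linear space, provided S
  -- lies in no C i: two points of S are adjacent, so they share some C i.
  module CliqueSpace (S : Subset n) (S-clique : IsClique G S) (S⊈C : ∀ i → ¬ (S ⊆ C i)) =
    LinearSpace S C disjoint (λ u v u∈S v∈S u≢v → proj₂ (S-clique u v u∈S v∈S u≢v))
      (λ i → not-subset-witness S (C i) (S⊈C i)) covers

  -- Every clique has at most k vertices: a clique inside some C i has at most |C i| ≤ k,
  -- and otherwise it is a linear space with k lines (de Bruijn–Erdős).
  clique-bound : (∀ i → ∣ C i ∣ ≤ k) → ∀ T → IsClique G T → ∣ T ∣ ≤ k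
  clique-bound ∣C∣≤k T T-clique with any? (λ i → T ⊆? C i)
  ... | yes (i , T⊆Ci) = ≤-trans (p⊆q⇒∣p∣≤∣q∣ T⊆Ci) (∣C∣≤k i)
  ... | no  T⊈any      = subst (_≤ k) (sym (∣∣≡count T)) points≤lines
    where open CliqueSpace T T-clique (λ i T⊆Ci → T⊈any (i , T⊆Ci))

  -- If a clique S with k vertices lies in no C i, every vertex x outside S is simplicial:
  -- x lies in a single C i, which therefore contains all its neighbours.
  outside-simplicial : ∀ S → IsClique G S → ∣ S ∣ ≡ k → (S⊈C : ∀ i → ¬ (S ⊆ C i)) →
    ∀ x → x ∉ S → Simplicial G x
  outside-simplicial S S-clique ∣S∣≡k S⊈C x x∉S a b (_ , i , x∈Ci , a∈Ci) (_ , j , x∈Cj , b∈Cj) a≢b =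
    a≢b , i , a∈Ci , subst (λ t → b ∈ C t) (sym same-line) b∈Cj
    where
    open CliqueSpace S S-clique S⊈C
    same-line : i ≡ j
    same-line = outside-unique (trans (sym (∣∣≡count S)) ∣S∣≡k) x i j x∉S x∈Ci x∈Cj

-- The theorem: ω(G) = k, and G is chordal as soon as some maximal k-clique S is not one
-- of the C i (maximality turns S ≢ C i into S ⊄ C i).
lemma3p4 : (k n : ℕ) → 1 ≤ k → (C : Fin k → Subset n) →
    (∀ i → ∣ C i ∣ ≡ k) → EdgeDisjoint C → Covers C →
    CliqueNumberIs (unionGraph C) k ×
    ((∃ λ (S : Subset n) → IsMaximalClique (unionGraph C) S × (∣ S ∣ ≡ k) × (∀ i → S ≢ C i)) →
    Chordal (unionGraph C))
lemma3p4 k n k≥1 C ∣C∣≡k disjoint covers = clique-number , chordal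
  where
  open UnionOfCliques C disjoint covers
  clique-number : CliqueNumberIs G k
  clique-number = (C i₀ , line-clique i₀ , ∣C∣≡k i₀) , clique-bound (≤-reflexive ∘ ∣C∣≡k)
    where
    i₀ : Fin k
    i₀ = fromℕ< k≥1
  chordal : (∃ λ S → IsMaximalClique G S × (∣ S ∣ ≡ k) × (∀ i → S ≢ C i)) → Chordal G
  chordal (S , (S-clique , S-maximal) , ∣S∣≡k , S≢C) =
    chordal-if-clique-covers-nonsimplicial G S S-clique (outside-simplicial S S-clique ∣S∣≡k S⊈C)
    where
    S⊈C : ∀ i → ¬ (S ⊆ C i)
    S⊈C i S⊆Ci = S≢C i (sym (S-maximal (C i) (line-clique i) S⊆Ci))
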